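{- Let $n\ge1$ and let $m_1,\dots,m_n\ge1$ be integers. For indices $k_1,\dots,k_n\ge1$ write $K_j=2(k_1+\cdots+k_j)$ and $M_j=2(m_1+\cdots+m_j)$ (with $M_0=0$), and let $M=m_1+\cdots+m_n$. Then $$\sum_{k_n\ge1}\cdots\sum_{k_1\ge1}\ \prod_{j=1}^{n}\frac{\prod_{i=1}^{m_j}q^{K_j+M_{j-1}+2i-1}}{\prod_{i=0}^{m_j}(1+q^{K_j+M_{j-1}+2i})}=\frac{\prod_{i=1}^{M}q^{2i-1}}{\prod_{i=1}^{M}(1+q^{2i})}\prod_{j=1}^{n}\frac{q^{2(m_j+m_{j+1}+\cdots+m_n)}}{1-q^{2(m_j+m_{j+1}+\cdots+m_n)}}.$$
   Context: The identity is understood as an identity of formal power series in $q$ (equivalently, of analytic functions for $|q|<1$). -}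

module Defs where

open import Data.Nat using (ℕ; zero; suc; _+_; _*_; _∸_; _≤_; _≡ᵇ_)
open import Data.Integer as ℤ using (ℤ; -_)
open import Data.Fin using (Fin; zero; suc; toℕ)
open import Data.Vec using (Vec; []; _∷_; lookup)
open import Data.Bool using (if_then_else_)
open import Data.Product using (∃-syntax)
open import Relation.Binary.PropositionalEquality using (_≡_)

-- Formal power series in q with integer coefficients: coefficient sequences.
PS : Set
PS = ℕ → ℤ

sumℕ : ℕ → (ℕ → ℤ) → ℤ
sumℕ zero f = ℤ.0ℤ
sumℕ (suc n) f = sumℕ n f ℤ.+ f n

sumFin : ∀ {n} → (Fin n → ℤ) → ℤ
sumFin {zero} f = ℤ.0ℤ
sumFin {suc n} f = f zero ℤ.+ sumFin (λ i → f (suc i))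

1ₚ : PS
1ₚ k = if k ≡ᵇ 0 then ℤ.1ℤ else ℤ.0ℤ

qpow : ℕ → PS
qpow a k = if k ≡ᵇ a then ℤ.1ℤ else ℤ.0ℤ

infixl 6 _+ₚ_ _-ₚ_
infixl 7 _*ₚ_ _/ₚ_

_+ₚ_ : PS → PS → PS
(f +ₚ g) k = f k ℤ.+ g k

_-ₚ_ : PS → PS → PS
(f -ₚ g) k = f k ℤ.- g k

_*ₚ_ : PS → PS → PS
(f *ₚ g) k = sumℕ (suc k) (λ i → f i ℤ.* g (k ∸ i))

-- Multiplicative inverse of a series f with constant term 1:
-- g 0 = 1, g n = - Σ_{i=1}^{n} f i * g (n - i).
-- invV f n = (g n , g (n-1) , … , g 0).
invV : PS → (n : ℕ) → Vec ℤ (suc n)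
invV f zero = ℤ.1ℤ ∷ []
invV f (suc n) =
  let v = invV f n in
  (- sumFin (λ (j : Fin (suc n)) → f (suc (toℕ j)) ℤ.* lookup v j)) ∷ v

inv : PS → PS
inv f n = lookup (invV f n) zero

-- a / b := a * b⁻¹ (only meaningful when b has constant term 1,
-- which is the case for every denominator used below)
_/ₚ_ : PS → PS → PS
f /ₚ g = f *ₚ inv g

prodUpTo : ℕ → (ℕ → PS) → PS
prodUpTo zero f = 1ₚ
prodUpTo (suc m) f = prodUpTo m f *ₚ f m

prodFin : ∀ {n} → (Fin n → PS) → PS
prodFin {zero} f = 1ₚ
prodFin {suc n} f = f zero *ₚ prodFin (λ i → f (suc i))

-- psum f t = f 0 + … + f (t-1)   (truncated at n)
psum : ∀ {n} → (Fin n → ℕ) → ℕ → ℕ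
psum {zero} f t = 0
psum {suc n} f zero = 0
psum {suc n} f (suc t) = f zero + psum (λ i → f (suc i)) t

cons : ∀ {n} → ℕ → (Fin n → ℕ) → Fin (suc n) → ℕ
cons x f zero = x
cons x f (suc i) = f i

-- Σ over k ∈ {1,…,B}^n of F k
boxSum : (n B : ℕ) → ((Fin n → ℕ) → ℤ) → ℤ
boxSum zero B F = F (λ ())
boxSum (suc n) B F = sumℕ B (λ k → boxSum n B (λ ks → F (cons (suc k) ks)))

-- S is the (q-adically convergent) sum of the family F indexed by
-- k = (k_1,…,k_n) with all k_j ≥ 1: every coefficient of the partial sums
-- over boxes {1..B}^n is eventually equal to the corresponding coefficient of S.
HasSum : (n : ℕ) → ((Fin n → ℕ) → PS) → PS → Set
HasSum n F S = ∀ N → ∃[ B ] (∀ B′ → B ≤ B′ → boxSum n B′ (λ k → F k N) ≡ S N)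

_≈ₚ_ : PS → PS → Set
f ≈ₚ g = ∀ N → f N ≡ g N

-- K_j = 2(k_1+…+k_j), for j (0-indexed) the (j+1)-st index
Kj : ∀ {n} → (Fin n → ℕ) → Fin n → ℕ
Kj k j = 2 * psum k (suc (toℕ j))

Mprev : ∀ {n} → (Fin n → ℕ) → Fin n → ℕ
Mprev m j = 2 * psum m (toℕ j)

tailSum : ∀ {n} → (Fin n → ℕ) → Fin n → ℕ
tailSum {n} m j = psum m n ∸ psum m (toℕ j)

LHSterm : ∀ {n} → (Fin n → ℕ) → (Fin n → ℕ) → PS
LHSterm m k = prodFin (λ j →
  prodUpTo (m j) (λ i → qpow (Kj k j + Mprev m j + 2 * i + 1))
  /ₚ prodUpTo (suc (m j)) (λ i → 1ₚ +ₚ qpow (Kj k j + Mprev m j + 2 * i)))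

RHS : ∀ {n} → (Fin n → ℕ) → PS
RHS {n} m =
  (prodUpTo (psum m n) (λ i → qpow (2 * i + 1))
   /ₚ prodUpTo (psum m n) (λ i → 1ₚ +ₚ qpow (2 * (i + 1))))
  *ₚ prodFin (λ j → qpow (2 * tailSum m j) /ₚ (1ₚ -ₚ qpow (2 * tailSum m j)))

-- Write num a m = ∏_{i<m} q^(a+2i+1), den a m = ∏_{i<m} (1 + q^(a+2i)), T a m = num a m / den a (m+1)
-- and G a m = num a m / den a m, so that the j-th factor of the summand is T (K_j + M_{j-1}) m_j.
-- Two identities in ℤ[[q]] carry the proof:
--   (1 − q^(2m)) T a m = G a m − G (a+2) m                  (telescoping in a),
--   T a m · num (a+2m) m′ / den (a+2m+2) m′ = T a (m+m′)     (merging consecutive blocks).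
-- By induction on n we show, for every offset c, that the sum with all exponents raised by c is
-- num c M / den (c+2) M · ∏_j W (m_j+⋯+m_n), where W t = q^(2t)/(1 − q^(2t)).  Summing out k_2,…,k_n
-- (offset c + 2k_1 + 2m_1) and merging leaves Σ_{k_1≥1} T (c+2k_1) M times the remaining product, and the
-- telescoping identity sums that to G (c+2) M / (1 − q^(2M)) = num c M / den (c+2) M · W M; after B terms the
-- remainder G (c+2B+2) M / (1 − q^(2M)) is divisible by q^B.  The theorem is the case c = 0.

{-# OPTIONS --safe #-}
module Submission where

open import Defs
open import Level using (0ℓ)
open import Function using (_∘_)
open import Data.Bool using (true; false; if_then_else_)
import Data.Bool as Bool
open import Data.Unit using (tt)
open import Data.Empty using (⊥-elim)
open import Data.Product using (∃-syntax; _×_; _,_)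
open import Data.Maybe using (Maybe; just; nothing)
open import Data.Sum using (inj₁; inj₂)
open import Data.Nat using (ℕ; zero; suc; _+_; _*_; _∸_; _≡ᵇ_; _≤_; _<_; _⊔_; _≤?_; _<?_; s≤s; z≤n)
import Data.Nat.Properties as ℕP
import Data.Nat.Tactic.RingSolver as ℕ-Solver
open import Data.Integer as ℤ using (ℤ; 0ℤ; 1ℤ; -_)
import Data.Integer.Properties as ℤP
import Data.Integer.Tactic.RingSolver as ℤ-Solver
open import Data.Fin using (Fin; toℕ; zero; suc)
open import Data.Vec using (lookup)
open import Relation.Nullary using (yes; no; ¬_)
open import Relation.Binary.PropositionalEquality
open import Algebra.Bundles using (CommutativeRing)
import Algebra.Construct.Pointwise ℕ as Pointwise
import Algebra.Solver.Ring.AlmostCommutativeRing as ACR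
import Relation.Binary.Reasoning.Setoid as SetoidReasoning
import Algebra.Properties.CommutativeSemigroup as CommutativeSemigroupProperties
import Algebra.Properties.Monoid as MonoidProperties

open CommutativeSemigroupProperties ℤP.+-commutativeSemigroup using () renaming (interchange to +-interchange)

sumℕ-cong-< : ∀ n {f g : ℕ → ℤ} → (∀ i → i < n → f i ≡ g i) → sumℕ n f ≡ sumℕ n g
sumℕ-cong-< zero    eq = refl
sumℕ-cong-< (suc n) eq = cong₂ ℤ._+_ (sumℕ-cong-< n (λ i i<n → eq i (ℕP.m<n⇒m<1+n i<n))) (eq n ℕP.≤-refl)

sumℕ-cong : ∀ n {f g : ℕ → ℤ} → (∀ i → f i ≡ g i) → sumℕ n f ≡ sumℕ n g
sumℕ-cong n eq = sumℕ-cong-< n (λ i _ → eq i)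

sumℕ-zero : ∀ n → sumℕ n (λ _ → 0ℤ) ≡ 0ℤ
sumℕ-zero zero    = refl
sumℕ-zero (suc n) = trans (ℤP.+-identityʳ _) (sumℕ-zero n)

sumℕ-head : ∀ n f → sumℕ (suc n) f ≡ f 0 ℤ.+ sumℕ n (f ∘ suc)
sumℕ-head zero    f = trans (ℤP.+-identityˡ (f 0)) (sym (ℤP.+-identityʳ (f 0)))
sumℕ-head (suc n) f = trans (cong (ℤ._+ f (suc n)) (sumℕ-head n f)) (ℤP.+-assoc (f 0) _ _)

sumℕ-distrib-+ : ∀ n f g → sumℕ n (λ i → f i ℤ.+ g i) ≡ sumℕ n f ℤ.+ sumℕ n g
sumℕ-distrib-+ zero    f g = refl
sumℕ-distrib-+ (suc n) f g =
  trans (cong (ℤ._+ (f n ℤ.+ g n)) (sumℕ-distrib-+ n f g)) (+-interchange (sumℕ n f) (sumℕ n g) (f n) (g n))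

*-distribˡ-sumℕ : ∀ n z f → z ℤ.* sumℕ n f ≡ sumℕ n (λ i → z ℤ.* f i)
*-distribˡ-sumℕ zero    z f = ℤP.*-zeroʳ z
*-distribˡ-sumℕ (suc n) z f = trans (ℤP.*-distribˡ-+ z _ _) (cong (ℤ._+ z ℤ.* f n) (*-distribˡ-sumℕ n z f))

-- The ring ℤ[[q]]

shift : PS → PS
shift f k = f (suc k)

*ₚ-suc : ∀ f g n → (f *ₚ g) (suc n) ≡ f 0 ℤ.* g (suc n) ℤ.+ (shift f *ₚ g) n
*ₚ-suc f g n = sumℕ-head (suc n) (λ i → f i ℤ.* g (suc n ∸ i))

*ₚ-suc-last : ∀ f g n → (f *ₚ g) (suc n) ≡ (f *ₚ shift g) n ℤ.+ f (suc n) ℤ.* g 0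
*ₚ-suc-last f g n = cong₂ ℤ._+_
  (sumℕ-cong-< (suc n) (λ i i<1+n → cong (λ j → f i ℤ.* g j) (ℕP.+-∸-assoc 1 (ℕP.m<1+n⇒m≤n i<1+n))))
  (cong (λ j → f (suc n) ℤ.* g j) (ℕP.n∸n≡0 n))

*ₚ-cong : ∀ {f f′ g g′} → f ≈ₚ f′ → g ≈ₚ g′ → (f *ₚ g) ≈ₚ (f′ *ₚ g′)
*ₚ-cong f≈f′ g≈g′ n = sumℕ-cong (suc n) (λ i → cong₂ ℤ._*_ (f≈f′ i) (g≈g′ (n ∸ i)))

*ₚ-comm : ∀ f g → (f *ₚ g) ≈ₚ (g *ₚ f)
*ₚ-comm f g zero    = cong (λ x → 0ℤ ℤ.+ x) (ℤP.*-comm (f 0) (g 0))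
*ₚ-comm f g (suc n) = begin
  (f *ₚ g) (suc n)                              ≡⟨ *ₚ-suc f g n ⟩
  f 0 ℤ.* g (suc n) ℤ.+ (shift f *ₚ g) n        ≡⟨ cong₂ ℤ._+_ (ℤP.*-comm (f 0) _) (*ₚ-comm (shift f) g n) ⟩
  g (suc n) ℤ.* f 0 ℤ.+ (g *ₚ shift f) n        ≡⟨ ℤP.+-comm (g (suc n) ℤ.* f 0) _ ⟩
  (g *ₚ shift f) n ℤ.+ g (suc n) ℤ.* f 0        ≡⟨ sym (*ₚ-suc-last g f n) ⟩
  (g *ₚ f) (suc n)                              ∎
  where open ≡-Reasoning

*ₚ-distribˡ : ∀ f g h → (f *ₚ (g +ₚ h)) ≈ₚ (f *ₚ g +ₚ f *ₚ h)
*ₚ-distribˡ f g h n =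
  trans (sumℕ-cong (suc n) (λ i → ℤP.*-distribˡ-+ (f i) (g (n ∸ i)) (h (n ∸ i)))) (sumℕ-distrib-+ (suc n) _ _)

*ₚ-distribʳ : ∀ f g h → ((g +ₚ h) *ₚ f) ≈ₚ (g *ₚ f +ₚ h *ₚ f)
*ₚ-distribʳ f g h n =
  trans (sumℕ-cong (suc n) (λ i → ℤP.*-distribʳ-+ (f (n ∸ i)) (g i) (h i))) (sumℕ-distrib-+ (suc n) _ _)

shift-*ₚ-*ₚ : ∀ f g h n → (shift (f *ₚ g) *ₚ h) n ≡ f 0 ℤ.* (shift g *ₚ h) n ℤ.+ ((shift f *ₚ g) *ₚ h) n
shift-*ₚ-*ₚ f g h n = begin
  sumℕ (suc n) (λ i → (f *ₚ g) (suc i) ℤ.* h (n ∸ i))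
    ≡⟨ sumℕ-cong (suc n) (λ i → trans (cong (ℤ._* h (n ∸ i)) (*ₚ-suc f g i)) (expand (f 0) (g (suc i)) ((shift f *ₚ g) i) (h (n ∸ i)))) ⟩
  sumℕ (suc n) (λ i → f 0 ℤ.* (g (suc i) ℤ.* h (n ∸ i)) ℤ.+ (shift f *ₚ g) i ℤ.* h (n ∸ i))
    ≡⟨ sumℕ-distrib-+ (suc n) _ _ ⟩
  sumℕ (suc n) (λ i → f 0 ℤ.* (g (suc i) ℤ.* h (n ∸ i))) ℤ.+ ((shift f *ₚ g) *ₚ h) n
    ≡⟨ cong (ℤ._+ ((shift f *ₚ g) *ₚ h) n) (sym (*-distribˡ-sumℕ (suc n) (f 0) _)) ⟩
  f 0 ℤ.* (shift g *ₚ h) n ℤ.+ ((shift f *ₚ g) *ₚ h) n ∎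
  where
  open ≡-Reasoning
  expand : ∀ a b c d → (a ℤ.* b ℤ.+ c) ℤ.* d ≡ a ℤ.* (b ℤ.* d) ℤ.+ c ℤ.* d
  expand = ℤ-Solver.solve-∀

*ₚ-assoc : ∀ f g h → ((f *ₚ g) *ₚ h) ≈ₚ (f *ₚ (g *ₚ h))
*ₚ-assoc f g h zero = rearrange (f 0) (g 0) (h 0)
  where
  rearrange : ∀ a b c → 0ℤ ℤ.+ (0ℤ ℤ.+ a ℤ.* b) ℤ.* c ≡ 0ℤ ℤ.+ a ℤ.* (0ℤ ℤ.+ b ℤ.* c)
  rearrange = ℤ-Solver.solve-∀
*ₚ-assoc f g h (suc n) = begin
  ((f *ₚ g) *ₚ h) (suc n)
    ≡⟨ *ₚ-suc (f *ₚ g) h n ⟩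
  (0ℤ ℤ.+ f 0 ℤ.* g 0) ℤ.* h (suc n) ℤ.+ (shift (f *ₚ g) *ₚ h) n
    ≡⟨ cong (λ x → (0ℤ ℤ.+ f 0 ℤ.* g 0) ℤ.* h (suc n) ℤ.+ x)
            (trans (shift-*ₚ-*ₚ f g h n) (cong (λ x → f 0 ℤ.* (shift g *ₚ h) n ℤ.+ x) (*ₚ-assoc (shift f) g h n))) ⟩
  (0ℤ ℤ.+ f 0 ℤ.* g 0) ℤ.* h (suc n) ℤ.+ (f 0 ℤ.* (shift g *ₚ h) n ℤ.+ (shift f *ₚ (g *ₚ h)) n)
    ≡⟨ rearrange (f 0) (g 0) (h (suc n)) ((shift g *ₚ h) n) ((shift f *ₚ (g *ₚ h)) n) ⟩
  f 0 ℤ.* (g 0 ℤ.* h (suc n) ℤ.+ (shift g *ₚ h) n) ℤ.+ (shift f *ₚ (g *ₚ h)) n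
    ≡⟨ cong (λ x → f 0 ℤ.* x ℤ.+ (shift f *ₚ (g *ₚ h)) n) (sym (*ₚ-suc g h n)) ⟩
  f 0 ℤ.* (g *ₚ h) (suc n) ℤ.+ (shift f *ₚ (g *ₚ h)) n
    ≡⟨ sym (*ₚ-suc f (g *ₚ h) n) ⟩
  (f *ₚ (g *ₚ h)) (suc n) ∎
  where
  open ≡-Reasoning
  rearrange : ∀ a b c d e → (0ℤ ℤ.+ a ℤ.* b) ℤ.* c ℤ.+ (a ℤ.* d ℤ.+ e) ≡ a ℤ.* (b ℤ.* c ℤ.+ d) ℤ.+ e
  rearrange = ℤ-Solver.solve-∀

*ₚ-zeroˡ : ∀ g → ((λ _ → 0ℤ) *ₚ g) ≈ₚ (λ _ → 0ℤ)
*ₚ-zeroˡ g n = trans (sumℕ-cong (suc n) (λ i → ℤP.*-zeroˡ (g (n ∸ i)))) (sumℕ-zero (suc n))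

*ₚ-identityˡ : ∀ f → (1ₚ *ₚ f) ≈ₚ f
*ₚ-identityˡ f zero    = trans (ℤP.+-identityˡ (1ℤ ℤ.* f 0)) (ℤP.*-identityˡ (f 0))
*ₚ-identityˡ f (suc n) = begin
  (1ₚ *ₚ f) (suc n)                     ≡⟨ *ₚ-suc 1ₚ f n ⟩
  1ℤ ℤ.* f (suc n) ℤ.+ (shift 1ₚ *ₚ f) n ≡⟨ cong₂ ℤ._+_ (ℤP.*-identityˡ (f (suc n))) (*ₚ-zeroˡ f n) ⟩
  f (suc n) ℤ.+ 0ℤ                       ≡⟨ ℤP.+-identityʳ (f (suc n)) ⟩
  f (suc n)                              ∎
  where open ≡-Reasoning

ℤ[[q]] : CommutativeRing 0ℓ 0ℓ
ℤ[[q]] = record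
  { Carrier = PS
  ; _≈_ = _≈ₚ_
  ; _+_ = _+ₚ_
  ; _*_ = _*ₚ_
  ; -_ = λ f k → - f k
  ; 0# = λ _ → 0ℤ
  ; 1# = 1ₚ
  ; isCommutativeRing = record
    { isRing = record
      { +-isAbelianGroup = Pointwise.isAbelianGroup ℤP.+-0-isAbelianGroup
      ; *-cong           = *ₚ-cong
      ; *-assoc          = *ₚ-assoc
      ; *-identity       = *ₚ-identityˡ , λ f n → trans (*ₚ-comm f 1ₚ n) (*ₚ-identityˡ f n)
      ; distrib          = *ₚ-distribˡ , *ₚ-distribʳ
      }
    ; *-comm = *ₚ-comm
    }
  }

module ℤ[[q]] = CommutativeRing ℤ[[q]]
open ℤ[[q]] using (*-cong; *-congˡ; *-congʳ; *-assoc; *-comm; *-identityˡ; *-identityʳ; +-cong)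
  renaming (refl to ≈ₚ-refl; sym to ≈ₚ-sym; trans to ≈ₚ-trans)
open MonoidProperties ℤ[[q]].*-monoid using (insertʳ)
open CommutativeSemigroupProperties ℤ[[q]].*-commutativeSemigroup using (xy∙z≈xz∙y) renaming (interchange to *-interchange)
module ≈ₚ-Reasoning = SetoidReasoning ℤ[[q]].setoid

-ₚ-cong : ∀ {f f′ g g′} → f ≈ₚ f′ → g ≈ₚ g′ → (f -ₚ g) ≈ₚ (f′ -ₚ g′)
-ₚ-cong f≈f′ g≈g′ N = cong₂ ℤ._-_ (f≈f′ N) (g≈g′ N)

constₚ : ℤ → PS
constₚ z k = if k ≡ᵇ 0 then z else 0ℤ

constₚ-homomorphism : ACR._-Raw-AlmostCommutative⟶_ ℤ.+-*-rawRing (ACR.fromCommutativeRing ℤ[[q]])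
constₚ-homomorphism = record
  { ⟦_⟧    = constₚ
  ; +-homo = λ { a b zero → refl ; a b (suc n) → refl }
  ; *-homo = λ { a b zero → sym (ℤP.+-identityˡ (a ℤ.* b))
               ; a b (suc n) → sym (trans (*ₚ-suc (constₚ a) (constₚ b) n)
                                          (cong₂ ℤ._+_ (ℤP.*-zeroʳ a) (*ₚ-zeroˡ (constₚ b) n))) }
  ; -‿homo = λ { a zero → refl ; a (suc n) → refl }
  ; 0-homo = λ { zero → refl ; (suc n) → refl }
  ; 1-homo = λ { zero → refl ; (suc n) → refl }
  }

constₚ-≟ : ∀ a b → Maybe (constₚ a ≈ₚ constₚ b)
constₚ-≟ a b with a ℤ.≟ b
... | yes refl = just ≈ₚ-refl
... | no _     = nothing

open import Algebra.Solver.Ring ℤ.+-*-rawRing (ACR.fromCommutativeRing ℤ[[q]]) constₚ-homomorphism constₚ-≟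
  using (solve; _:=_; _:+_; _:-_; _:*_; con)

-- Inverses of series with constant term 1

lookup-invV : ∀ f n (j : Fin (suc n)) → lookup (invV f n) j ≡ inv f (n ∸ toℕ j)
lookup-invV f zero    zero    = refl
lookup-invV f (suc n) zero    = refl
lookup-invV f (suc n) (suc j) = lookup-invV f n j

sumFin-cong : ∀ {n} {φ ψ : Fin n → ℤ} → (∀ j → φ j ≡ ψ j) → sumFin φ ≡ sumFin ψ
sumFin-cong {zero}  eq = refl
sumFin-cong {suc n} eq = cong₂ ℤ._+_ (eq zero) (sumFin-cong (eq ∘ suc))

sumFin≡sumℕ : ∀ n (φ : ℕ → ℤ) → sumFin {n} (φ ∘ toℕ) ≡ sumℕ n φ
sumFin≡sumℕ zero    φ = refl
sumFin≡sumℕ (suc n) φ = trans (cong (λ s → φ 0 ℤ.+ s) (sumFin≡sumℕ n (φ ∘ suc))) (sym (sumℕ-head n φ))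

inv-suc : ∀ f n → inv f (suc n) ≡ - (shift f *ₚ inv f) n
inv-suc f n = cong -_ (trans (sumFin-cong (λ j → cong (f (suc (toℕ j)) ℤ.*_) (lookup-invV f n j)))
                             (sumFin≡sumℕ (suc n) (λ i → f (suc i) ℤ.* inv f (n ∸ i))))

inv-inverseʳ : ∀ f → f 0 ≡ 1ℤ → (f *ₚ inv f) ≈ₚ 1ₚ
inv-inverseʳ f f₀≡1 zero    rewrite f₀≡1 = refl
inv-inverseʳ f f₀≡1 (suc n) = begin
  (f *ₚ inv f) (suc n)                       ≡⟨ *ₚ-suc f (inv f) n ⟩
  f 0 ℤ.* inv f (suc n) ℤ.+ (shift f *ₚ inv f) n ≡⟨ cong₂ (λ a b → a ℤ.* b ℤ.+ (shift f *ₚ inv f) n) f₀≡1 (inv-suc f n) ⟩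
  1ℤ ℤ.* - (shift f *ₚ inv f) n ℤ.+ (shift f *ₚ inv f) n ≡⟨ cancel ((shift f *ₚ inv f) n) ⟩
  0ℤ                                         ∎
  where
  open ≡-Reasoning
  cancel : ∀ x → 1ℤ ℤ.* - x ℤ.+ x ≡ 0ℤ
  cancel = ℤ-Solver.solve-∀

*ₚ-const-1 : ∀ {f g} → f 0 ≡ 1ℤ → g 0 ≡ 1ℤ → (f *ₚ g) 0 ≡ 1ℤ
*ₚ-const-1 f₀≡1 g₀≡1 rewrite f₀≡1 | g₀≡1 = refl

inv-unique : ∀ f g → f 0 ≡ 1ℤ → (f *ₚ g) ≈ₚ 1ₚ → g ≈ₚ inv f
inv-unique f g f₀≡1 fg≈1 = begin
  g                  ≈⟨ insertʳ {a = f} {c = inv f} (inv-inverseʳ f f₀≡1) g ⟩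
  (g *ₚ f) *ₚ inv f  ≈⟨ *-congʳ {inv f} (≈ₚ-trans (*-comm g f) fg≈1) ⟩
  1ₚ *ₚ inv f        ≈⟨ *-identityˡ (inv f) ⟩
  inv f              ∎
  where open ≈ₚ-Reasoning

inv-cong : ∀ {f g} → f 0 ≡ 1ℤ → f ≈ₚ g → inv f ≈ₚ inv g
inv-cong {f} {g} f₀≡1 f≈g =
  inv-unique g (inv f) (trans (sym (f≈g 0)) f₀≡1) (≈ₚ-trans (*-congʳ {inv f} (≈ₚ-sym f≈g)) (inv-inverseʳ f f₀≡1))

inv-*ₚ : ∀ f g → f 0 ≡ 1ℤ → g 0 ≡ 1ℤ → inv (f *ₚ g) ≈ₚ (inv f *ₚ inv g)
inv-*ₚ f g f₀≡1 g₀≡1 = ≈ₚ-sym (inv-unique (f *ₚ g) (inv f *ₚ inv g) (*ₚ-const-1 {f} {g} f₀≡1 g₀≡1) (begin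
  (f *ₚ g) *ₚ (inv f *ₚ inv g)      ≈⟨ *-interchange f g (inv f) (inv g) ⟩
  (f *ₚ inv f) *ₚ (g *ₚ inv g)      ≈⟨ *-cong (inv-inverseʳ f f₀≡1) (inv-inverseʳ g g₀≡1) ⟩
  1ₚ *ₚ 1ₚ                          ≈⟨ *-identityˡ 1ₚ ⟩
  1ₚ                                ∎))
  where open ≈ₚ-Reasoning

inv-1ₚ : inv 1ₚ ≈ₚ 1ₚ
inv-1ₚ = ≈ₚ-sym (inv-unique 1ₚ 1ₚ refl (*-identityˡ 1ₚ))

/ₚ-cong : ∀ {a a′ b b′} → b 0 ≡ 1ℤ → a ≈ₚ a′ → b ≈ₚ b′ → (a /ₚ b) ≈ₚ (a′ /ₚ b′)
/ₚ-cong b₀≡1 a≈a′ b≈b′ = *-cong a≈a′ (inv-cong b₀≡1 b≈b′)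

x*b≈a⇒x≈a/b : ∀ {x a b} → b 0 ≡ 1ℤ → (x *ₚ b) ≈ₚ a → x ≈ₚ (a /ₚ b)
x*b≈a⇒x≈a/b {x} {a} {b} b₀≡1 xb≈a = ≈ₚ-trans (insertʳ {a = b} {c = inv b} (inv-inverseʳ b b₀≡1) x) (*-congʳ {inv b} xb≈a)

/ₚ-*ₚ-/ₚ : ∀ a b c d → b 0 ≡ 1ℤ → d 0 ≡ 1ℤ → ((a /ₚ b) *ₚ (c /ₚ d)) ≈ₚ ((a *ₚ c) /ₚ (b *ₚ d))
/ₚ-*ₚ-/ₚ a b c d b₀≡1 d₀≡1 =
  ≈ₚ-trans (*-interchange a (inv b) c (inv d)) (*-congˡ {a *ₚ c} (≈ₚ-sym (inv-*ₚ b d b₀≡1 d₀≡1)))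

/ₚ-cancelʳ : ∀ a b c → b 0 ≡ 1ℤ → c 0 ≡ 1ℤ → ((a *ₚ c) /ₚ (b *ₚ c)) ≈ₚ (a /ₚ b)
/ₚ-cancelʳ a b c b₀≡1 c₀≡1 = begin
  (a *ₚ c) /ₚ (b *ₚ c)       ≈⟨ ≈ₚ-sym (/ₚ-*ₚ-/ₚ a b c c b₀≡1 c₀≡1) ⟩
  (a /ₚ b) *ₚ (c *ₚ inv c)   ≈⟨ *-congˡ {a /ₚ b} (inv-inverseʳ c c₀≡1) ⟩
  (a /ₚ b) *ₚ 1ₚ             ≈⟨ *-identityʳ (a /ₚ b) ⟩
  a /ₚ b                     ∎
  where open ≈ₚ-Reasoning

-- Monomials and divisibility by powers of q

qpow-≢ : ∀ a k → ¬ k ≡ a → qpow a k ≡ 0ℤ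
qpow-≢ a k k≢a with k ≡ᵇ a in k≡ᵇa
... | true  = ⊥-elim (k≢a (ℕP.≡ᵇ⇒≡ k a (subst Bool.T (sym k≡ᵇa) tt)))
... | false = refl

qpow-+-+ : ∀ a b d → qpow (a + b) (a + d) ≡ qpow b d
qpow-+-+ zero    b d = refl
qpow-+-+ (suc a) b d = qpow-+-+ a b d

qpow-*ₚ : ∀ a f n → (qpow a *ₚ f) (a + n) ≡ f n
qpow-*ₚ zero    f n = *-identityˡ f n
qpow-*ₚ (suc a) f n = begin
  (qpow (suc a) *ₚ f) (suc a + n)             ≡⟨ *ₚ-suc (qpow (suc a)) f (a + n) ⟩
  0ℤ ℤ.* f (suc a + n) ℤ.+ (qpow a *ₚ f) (a + n) ≡⟨ cong₂ ℤ._+_ (ℤP.*-zeroˡ (f (suc a + n))) (qpow-*ₚ a f n) ⟩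
  0ℤ ℤ.+ f n                                  ≡⟨ ℤP.+-identityˡ (f n) ⟩
  f n                                         ∎
  where open ≡-Reasoning

infix 4 q^_∣_

q^_∣_ : ℕ → PS → Set
q^ d ∣ f = ∀ i → i < d → f i ≡ 0ℤ

q^∣qpow : ∀ a → q^ a ∣ qpow a
q^∣qpow a i i<a = qpow-≢ a i (λ i≡a → ℕP.<-irrefl i≡a i<a)

q^∣-≤ : ∀ {d d′ f} → d′ ≤ d → q^ d ∣ f → q^ d′ ∣ f
q^∣-≤ d′≤d d∣f i i<d′ = d∣f i (ℕP.<-≤-trans i<d′ d′≤d)

q^∣-resp-≈ : ∀ {d f g} → f ≈ₚ g → q^ d ∣ f → q^ d ∣ g
q^∣-resp-≈ f≈g d∣f i i<d = trans (sym (f≈g i)) (d∣f i i<d)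

∣f⇒∣f*g : ∀ {d f} g → q^ d ∣ f → q^ d ∣ f *ₚ g
∣f⇒∣f*g {d} {f} g d∣f i i<d = trans (sumℕ-cong-< (suc i) vanishes) (sumℕ-zero (suc i))
  where
  vanishes : ∀ j → j < suc i → f j ℤ.* g (i ∸ j) ≡ 0ℤ
  vanishes j j<1+i = trans (cong (ℤ._* g (i ∸ j)) (d∣f j (ℕP.≤-<-trans (ℕP.m<1+n⇒m≤n j<1+i) i<d)))
                           (ℤP.*-zeroˡ (g (i ∸ j)))

∣g⇒∣f*g : ∀ {d g} f → q^ d ∣ g → q^ d ∣ f *ₚ g
∣g⇒∣f*g {g = g} f d∣g = q^∣-resp-≈ (*-comm g f) (∣f⇒∣f*g f d∣g)

qpow-+ : ∀ a b → (qpow a *ₚ qpow b) ≈ₚ qpow (a + b)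
qpow-+ a b N with a ≤? N
... | yes a≤N = subst (λ N → (qpow a *ₚ qpow b) N ≡ qpow (a + b) N) (ℕP.m+[n∸m]≡n a≤N)
                      (trans (qpow-*ₚ a (qpow b) (N ∸ a)) (sym (qpow-+-+ a b (N ∸ a))))
... | no a≰N  = trans (∣f⇒∣f*g (qpow b) (q^∣qpow a) N (ℕP.≰⇒> a≰N))
                      (sym (qpow-≢ (a + b) N (λ N≡a+b → a≰N (subst (a ≤_) (sym N≡a+b) (ℕP.m≤m+n a b)))))

prodUpTo-cong : ∀ m {f g : ℕ → PS} → (∀ i → f i ≈ₚ g i) → prodUpTo m f ≈ₚ prodUpTo m g
prodUpTo-cong zero    f≈g = ≈ₚ-refl
prodUpTo-cong (suc m) f≈g = *-cong (prodUpTo-cong m f≈g) (f≈g m)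

prodUpTo-+ : ∀ p q f → prodUpTo (p + q) f ≈ₚ (prodUpTo p f *ₚ prodUpTo q (λ i → f (p + i)))
prodUpTo-+ p zero    f rewrite ℕP.+-identityʳ p = ≈ₚ-sym (*-identityʳ (prodUpTo p f))
prodUpTo-+ p (suc q) f rewrite ℕP.+-suc p q =
  ≈ₚ-trans (*-congʳ {f (p + q)} (prodUpTo-+ p q f))
           (*-assoc (prodUpTo p f) (prodUpTo q (λ i → f (p + i))) (f (p + q)))

prodUpTo-suc-head : ∀ m f → prodUpTo (suc m) f ≈ₚ (prodUpTo m (f ∘ suc) *ₚ f 0)
prodUpTo-suc-head zero    f = ≈ₚ-refl
prodUpTo-suc-head (suc m) f = ≈ₚ-trans (*-congʳ {f (suc m)} (prodUpTo-suc-head m f))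
                                       (xy∙z≈xz∙y (prodUpTo m (f ∘ suc)) (f 0) (f (suc m)))

prodUpTo-const-1 : ∀ m f → (∀ i → f i 0 ≡ 1ℤ) → prodUpTo m f 0 ≡ 1ℤ
prodUpTo-const-1 zero    f f₀≡1 = refl
prodUpTo-const-1 (suc m) f f₀≡1 = *ₚ-const-1 {prodUpTo m f} {f m} (prodUpTo-const-1 m f f₀≡1) (f₀≡1 m)

prodFin-cong : ∀ {n} {f g : Fin n → PS} → (∀ j → f j ≈ₚ g j) → prodFin f ≈ₚ prodFin g
prodFin-cong {zero}  f≈g = ≈ₚ-refl
prodFin-cong {suc n} f≈g = *-cong (f≈g zero) (prodFin-cong (f≈g ∘ suc))

-- The blocks T and G

num : ℕ → ℕ → PS
num a m = prodUpTo m (λ i → qpow (a + 2 * i + 1))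

den : ℕ → ℕ → PS
den a m = prodUpTo m (λ i → 1ₚ +ₚ qpow (a + 2 * i))

T : ℕ → ℕ → PS
T a m = num a m /ₚ den a (suc m)

G : ℕ → ℕ → PS
G a m = num a m /ₚ den a m

1+qpow-const-1 : ∀ b → 1 ≤ b → (1ₚ +ₚ qpow b) 0 ≡ 1ℤ
1+qpow-const-1 (suc b) _ = refl

1-qpow-const-1 : ∀ b → 1 ≤ b → (1ₚ -ₚ qpow b) 0 ≡ 1ℤ
1-qpow-const-1 (suc b) _ = refl

den-const-1 : ∀ a m → 1 ≤ a → den a m 0 ≡ 1ℤ
den-const-1 a m 1≤a =
  prodUpTo-const-1 m _ (λ i → 1+qpow-const-1 (a + 2 * i) (ℕP.≤-trans 1≤a (ℕP.m≤m+n a (2 * i))))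

den-+2-const-1 : ∀ a m → den (a + 2) m 0 ≡ 1ℤ
den-+2-const-1 a m = den-const-1 (a + 2) m (ℕP.≤-trans (s≤s z≤n) (ℕP.m≤n+m 2 a))

num-+2 : ∀ a m → num (a + 2) m ≈ₚ (qpow (2 * m) *ₚ num a m)
num-+2 a zero    = ≈ₚ-sym (*-identityˡ 1ₚ)
num-+2 a (suc m) = begin
  num (a + 2) m *ₚ qpow (a + 2 + 2 * m + 1)
    ≈⟨ *-cong (num-+2 a m) (≈ₚ-trans (cong-app (cong qpow (shift-exponent a m))) (≈ₚ-sym (qpow-+ 2 _))) ⟩
  (qpow (2 * m) *ₚ num a m) *ₚ (qpow 2 *ₚ qpow (a + 2 * m + 1))
    ≈⟨ *-interchange (qpow (2 * m)) (num a m) (qpow 2) (qpow (a + 2 * m + 1)) ⟩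
  (qpow (2 * m) *ₚ qpow 2) *ₚ num a (suc m)
    ≈⟨ *-congʳ {num a (suc m)} (≈ₚ-trans (qpow-+ (2 * m) 2) (cong-app (cong qpow (double-suc m)))) ⟩
  qpow (2 * suc m) *ₚ num a (suc m) ∎
  where
  open ≈ₚ-Reasoning
  shift-exponent : ∀ a m → a + 2 + 2 * m + 1 ≡ 2 + (a + 2 * m + 1)
  shift-exponent = ℕ-Solver.solve-∀
  double-suc : ∀ m → 2 * m + 2 ≡ 2 * suc m
  double-suc = ℕ-Solver.solve-∀

den-head : ∀ a m → den a (suc m) ≈ₚ (den (a + 2) m *ₚ (1ₚ +ₚ qpow a))
den-head a m = ≈ₚ-trans (prodUpTo-suc-head m _)
  (*-cong (prodUpTo-cong m (λ i → +-cong {1ₚ} ≈ₚ-refl (cong-app (cong qpow (shift-exponent a i)))))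
          (+-cong {1ₚ} ≈ₚ-refl (cong-app (cong qpow (ℕP.+-identityʳ a)))))
  where
  shift-exponent : ∀ a i → a + 2 * suc i ≡ a + 2 + 2 * i
  shift-exponent = ℕ-Solver.solve-∀

num-+ : ∀ a m m′ → num a (m + m′) ≈ₚ (num a m *ₚ num (a + 2 * m) m′)
num-+ a m m′ = ≈ₚ-trans (prodUpTo-+ m m′ _)
  (*-congˡ {num a m} (prodUpTo-cong m′ (λ i → cong-app (cong qpow (regroup a m i)))))
  where
  regroup : ∀ a m i → a + 2 * (m + i) + 1 ≡ a + 2 * m + 2 * i + 1
  regroup = ℕ-Solver.solve-∀

den-+ : ∀ a m m′ → den a (m + m′) ≈ₚ (den a m *ₚ den (a + 2 * m) m′)
den-+ a m m′ = ≈ₚ-trans (prodUpTo-+ m m′ _)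
  (*-congˡ {den a m} (prodUpTo-cong m′ (λ i → +-cong {1ₚ} ≈ₚ-refl (cong-app (cong qpow (regroup a m i))))))
  where
  regroup : ∀ a m i → a + 2 * (m + i) ≡ a + 2 * m + 2 * i
  regroup = ℕ-Solver.solve-∀

T-merge : ∀ a m m′ → 1 ≤ a → (T a m *ₚ (num (a + 2 * m) m′ /ₚ den (a + 2 * m + 2) m′)) ≈ₚ T a (m + m′)
T-merge a m m′ 1≤a = begin
  (num a m /ₚ D) *ₚ (num (a + 2 * m) m′ /ₚ D′)        ≈⟨ /ₚ-*ₚ-/ₚ (num a m) D (num (a + 2 * m) m′) D′ D₀≡1 D′₀≡1 ⟩
  (num a m *ₚ num (a + 2 * m) m′) /ₚ (D *ₚ D′)        ≈⟨ /ₚ-cong (*ₚ-const-1 {D} {D′} D₀≡1 D′₀≡1)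
                                                                 (≈ₚ-sym (num-+ a m m′)) (≈ₚ-sym den-split) ⟩
  num a (m + m′) /ₚ den a (suc m + m′)                ∎
  where
  open ≈ₚ-Reasoning
  D  = den a (suc m)
  D′ = den (a + 2 * m + 2) m′
  D₀≡1  = den-const-1 a (suc m) 1≤a
  D′₀≡1 = den-+2-const-1 (a + 2 * m) m′
  double-suc : ∀ a m → a + 2 * suc m ≡ a + 2 * m + 2
  double-suc = ℕ-Solver.solve-∀
  den-split : den a (suc m + m′) ≈ₚ (D *ₚ D′)
  den-split = ≈ₚ-trans (den-+ a (suc m) m′) (*-congˡ {D} (cong-app (cong (λ b → den b m′) (double-suc a m))))

T-telescopes : ∀ a M → 1 ≤ a → ((1ₚ -ₚ qpow (2 * M)) *ₚ T a M) ≈ₚ (G a M -ₚ G (a + 2) M)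
T-telescopes a M 1≤a = begin
  (1ₚ -ₚ Q) *ₚ (num a M /ₚ D)
    ≈⟨ ≈ₚ-sym (*-assoc (1ₚ -ₚ Q) (num a M) (inv D)) ⟩
  ((1ₚ -ₚ Q) *ₚ num a M) /ₚ D
    ≈⟨ *-congʳ {inv D} numerator ⟩
  (num a M *ₚ c₁ -ₚ (Q *ₚ num a M) *ₚ c₂) /ₚ D
    ≈⟨ solve 3 (λ x y i → (x :- y) :* i := x :* i :- y :* i) ≈ₚ-refl (num a M *ₚ c₁) ((Q *ₚ num a M) *ₚ c₂) (inv D) ⟩
  (num a M *ₚ c₁) /ₚ (den a M *ₚ c₁) -ₚ ((Q *ₚ num a M) *ₚ c₂) /ₚ D
    ≈⟨ -ₚ-cong (/ₚ-cancelʳ (num a M) (den a M) c₁ (den-const-1 a M 1≤a) c₁₀≡1) second ⟩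
  G a M -ₚ G (a + 2) M ∎
  where
  open ≈ₚ-Reasoning
  Q  = qpow (2 * M)
  c₁ = 1ₚ +ₚ qpow (a + 2 * M)
  c₂ = 1ₚ +ₚ qpow a
  D  = den a (suc M)
  c₁₀≡1 = 1+qpow-const-1 (a + 2 * M) (ℕP.≤-trans 1≤a (ℕP.m≤m+n a (2 * M)))
  numerator : ((1ₚ -ₚ Q) *ₚ num a M) ≈ₚ (num a M *ₚ c₁ -ₚ (Q *ₚ num a M) *ₚ c₂)
  numerator = begin
    (1ₚ -ₚ Q) *ₚ num a M
      ≈⟨ solve 3 (λ n x y → (con 1ℤ :- x) :* n := n :* (con 1ℤ :+ x :* y) :- (x :* n) :* (con 1ℤ :+ y))
               ≈ₚ-refl (num a M) Q (qpow a) ⟩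
    num a M *ₚ (1ₚ +ₚ Q *ₚ qpow a) -ₚ (Q *ₚ num a M) *ₚ c₂
      ≈⟨ -ₚ-cong (*-congˡ {num a M} (+-cong {1ₚ} ≈ₚ-refl
                   (≈ₚ-trans (qpow-+ (2 * M) a) (cong-app (cong qpow (ℕP.+-comm (2 * M) a))))))
                 ≈ₚ-refl ⟩
    num a M *ₚ c₁ -ₚ (Q *ₚ num a M) *ₚ c₂ ∎
  second : (((Q *ₚ num a M) *ₚ c₂) /ₚ D) ≈ₚ G (a + 2) M
  second = begin
    ((Q *ₚ num a M) *ₚ c₂) /ₚ D
      ≈⟨ *-congˡ {(Q *ₚ num a M) *ₚ c₂} (inv-cong (den-const-1 a (suc M) 1≤a) (den-head a M)) ⟩
    ((Q *ₚ num a M) *ₚ c₂) /ₚ (den (a + 2) M *ₚ c₂)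
      ≈⟨ /ₚ-cancelʳ (Q *ₚ num a M) (den (a + 2) M) c₂ (den-+2-const-1 a M) (1+qpow-const-1 a 1≤a) ⟩
    (Q *ₚ num a M) /ₚ den (a + 2) M
      ≈⟨ *-congʳ {inv (den (a + 2) M)} (≈ₚ-sym (num-+2 a M)) ⟩
    G (a + 2) M ∎

q^a∣num : ∀ a m → 1 ≤ m → q^ a ∣ num a m
q^a∣num a (suc m) _ =
  ∣g⇒∣f*g (num a m) (q^∣-≤ (ℕP.≤-trans (ℕP.m≤m+n a (2 * m)) (ℕP.m≤m+n (a + 2 * m) 1)) (q^∣qpow (a + 2 * m + 1)))

q^a∣T : ∀ a m → 1 ≤ m → q^ a ∣ T a m
q^a∣T a m 1≤m = ∣f⇒∣f*g (inv (den a (suc m))) (q^a∣num a m 1≤m)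

q^a∣G : ∀ a m → 1 ≤ m → q^ a ∣ G a m
q^a∣G a m 1≤m = ∣f⇒∣f*g (inv (den a m)) (q^a∣num a m 1≤m)

sumₚ : ℕ → (ℕ → PS) → PS
sumₚ B t N = sumℕ B (λ k → t k N)

sumₚ-*ʳ : ∀ B (t : ℕ → PS) P → sumₚ B (λ k → t k *ₚ P) ≈ₚ (sumₚ B t *ₚ P)
sumₚ-*ʳ zero    t P = ≈ₚ-sym (*ₚ-zeroˡ P)
sumₚ-*ʳ (suc B) t P = ≈ₚ-trans (+-cong (sumₚ-*ʳ B t P) (≈ₚ-refl {t B *ₚ P})) (≈ₚ-sym (ℤ[[q]].distribʳ P (sumₚ B t) (t B)))

telescope : ∀ u (t g : ℕ → PS) B → (∀ k → (u *ₚ t k) ≈ₚ (g k -ₚ g (suc k))) → (u *ₚ sumₚ B t) ≈ₚ (g 0 -ₚ g B)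
telescope u t g zero    step = ≈ₚ-trans (ℤ[[q]].zeroʳ u) (λ N → sym (ℤP.+-inverseʳ (g 0 N)))
telescope u t g (suc B) step = begin
  u *ₚ (sumₚ B t +ₚ t B)                ≈⟨ ℤ[[q]].distribˡ u (sumₚ B t) (t B) ⟩
  u *ₚ sumₚ B t +ₚ u *ₚ t B             ≈⟨ +-cong (telescope u t g B step) (step B) ⟩
  (g 0 -ₚ g B) +ₚ (g B -ₚ g (suc B))    ≈⟨ solve 3 (λ x y z → (x :- y) :+ (y :- z) := x :- z) ≈ₚ-refl (g 0) (g B) (g (suc B)) ⟩
  g 0 -ₚ g (suc B)                      ∎
  where open ≈ₚ-Reasoning

W : ℕ → PS
W t = qpow (2 * t) /ₚ (1ₚ -ₚ qpow (2 * t))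

T-sum-remainder : ∀ c M P B → 1 ≤ M →
  (((num c M /ₚ den (c + 2) M) *ₚ (W M *ₚ P)) -ₚ sumₚ B (λ k → T (c + 2 * suc k) M *ₚ P))
    ≈ₚ ((G (c + 2 * suc B) M /ₚ (1ₚ -ₚ qpow (2 * M))) *ₚ P)
T-sum-remainder c M P B 1≤M = begin
  H *ₚ (W M *ₚ P) -ₚ sumₚ B (λ k → T (a k) M *ₚ P)
    ≈⟨ -ₚ-cong whole (≈ₚ-trans (sumₚ-*ʳ B (λ k → T (a k) M) P) (*-congʳ {P} partial)) ⟩
  (G (c + 2) M /ₚ u) *ₚ P -ₚ ((G (c + 2) M -ₚ G (a B) M) /ₚ u) *ₚ P
    ≈⟨ solve 4 (λ x y i p → (x :* i) :* p :- ((x :- y) :* i) :* p := (y :* i) :* p)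
             ≈ₚ-refl (G (c + 2) M) (G (a B) M) (inv u) P ⟩
  (G (a B) M /ₚ u) *ₚ P ∎
  where
  open ≈ₚ-Reasoning
  a : ℕ → ℕ
  a k = c + 2 * suc k
  Q = qpow (2 * M)
  u = 1ₚ -ₚ Q
  H = num c M /ₚ den (c + 2) M
  whole : (H *ₚ (W M *ₚ P)) ≈ₚ ((G (c + 2) M /ₚ u) *ₚ P)
  whole = begin
    (num c M *ₚ inv (den (c + 2) M)) *ₚ ((Q *ₚ inv u) *ₚ P)
      ≈⟨ solve 5 (λ n d x i p → (n :* d) :* ((x :* i) :* p) := ((x :* n) :* d) :* i :* p)
               ≈ₚ-refl (num c M) (inv (den (c + 2) M)) Q (inv u) P ⟩
    (((Q *ₚ num c M) /ₚ den (c + 2) M) /ₚ u) *ₚ P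
      ≈⟨ *-congʳ {P} (*-congʳ {inv u} (*-congʳ {inv (den (c + 2) M)} (≈ₚ-sym (num-+2 c M)))) ⟩
    (G (c + 2) M /ₚ u) *ₚ P ∎
  step : ∀ k → (u *ₚ T (a k) M) ≈ₚ (G (a k) M -ₚ G (a (suc k)) M)
  step k = ≈ₚ-trans (T-telescopes (a k) M (ℕP.≤-trans (s≤s z≤n) (ℕP.m≤n+m (2 * suc k) c)))
                    (-ₚ-cong (≈ₚ-refl {G (a k) M}) (cong-app (cong (λ b → G b M) (next c k))))
    where
    next : ∀ c k → c + 2 * suc k + 2 ≡ c + 2 * suc (suc k)
    next = ℕ-Solver.solve-∀
  partial : sumₚ B (λ k → T (a k) M) ≈ₚ ((G (c + 2) M -ₚ G (a B) M) /ₚ u)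
  partial = x*b≈a⇒x≈a/b (1-qpow-const-1 (2 * M) (ℕP.≤-trans 1≤M (ℕP.m≤m+n M (M + 0))))
              (≈ₚ-trans (*-comm (sumₚ B (λ k → T (a k) M)) u) (telescope u (λ k → T (a k) M) (λ k → G (a k) M) B step))

-- Summation over boxes

Eventually : (ℕ → Set) → Set
Eventually P = ∃[ B ] (∀ B′ → B ≤ B′ → P B′)

eventually-≥ : ∀ N → Eventually (N ≤_)
eventually-≥ N = N , λ _ N≤B′ → N≤B′

eventually-map : ∀ {P Q : ℕ → Set} → (∀ {B} → P B → Q B) → Eventually P → Eventually Q
eventually-map P⇒Q (B , ev) = B , λ B′ B≤B′ → P⇒Q (ev B′ B≤B′)

eventually-× : ∀ {P Q : ℕ → Set} → Eventually P → Eventually Q → Eventually (λ B → P B × Q B)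
eventually-× (B₁ , ev₁) (B₂ , ev₂) =
  B₁ ⊔ B₂ , λ B′ B₁⊔B₂≤B′ → ev₁ B′ (ℕP.m⊔n≤o⇒m≤o B₁ B₂ B₁⊔B₂≤B′) , ev₂ B′ (ℕP.m⊔n≤o⇒n≤o B₁ B₂ B₁⊔B₂≤B′)

eventually-∀< : ∀ L {P : ℕ → ℕ → Set} → (∀ i → i < L → Eventually (P i)) → Eventually (λ B → ∀ i → i < L → P i B)
eventually-∀< zero        ev = 0 , λ _ _ _ ()
eventually-∀< (suc L) {P} ev =
  eventually-map combine (eventually-× (eventually-∀< L (λ i i<L → ev i (ℕP.m<n⇒m<1+n i<L))) (ev L ℕP.≤-refl))
  where
  combine : ∀ {B} → (∀ i → i < L → P i B) × P L B → ∀ i → i < suc L → P i B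
  combine (below , at) i i<1+L with ℕP.m<1+n⇒m<n∨m≡n i<1+L
  ... | inj₁ i<L  = below i i<L
  ... | inj₂ refl = at

boxSum-cong : ∀ n B {F G : (Fin n → ℕ) → ℤ} → (∀ k → F k ≡ G k) → boxSum n B F ≡ boxSum n B G
boxSum-cong zero    B F≡G = F≡G _
boxSum-cong (suc n) B F≡G = sumℕ-cong B (λ k → boxSum-cong n B (λ ks → F≡G (cons (suc k) ks)))

boxSum-zero : ∀ n B → boxSum n B (λ _ → 0ℤ) ≡ 0ℤ
boxSum-zero zero    B = refl
boxSum-zero (suc n) B = trans (sumℕ-cong B (λ k → boxSum-zero n B)) (sumℕ-zero B)

boxSum-distrib-+ : ∀ n B (F G : (Fin n → ℕ) → ℤ) → boxSum n B (λ k → F k ℤ.+ G k) ≡ boxSum n B F ℤ.+ boxSum n B G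
boxSum-distrib-+ zero    B F G = refl
boxSum-distrib-+ (suc n) B F G =
  trans (sumℕ-cong B (λ k → boxSum-distrib-+ n B (F ∘ cons (suc k)) (G ∘ cons (suc k)))) (sumℕ-distrib-+ B _ _)

*-distribˡ-boxSum : ∀ n B z (F : (Fin n → ℕ) → ℤ) → z ℤ.* boxSum n B F ≡ boxSum n B (λ k → z ℤ.* F k)
*-distribˡ-boxSum zero    B z F = refl
*-distribˡ-boxSum (suc n) B z F =
  trans (*-distribˡ-sumℕ B z _) (sumℕ-cong B (λ k → *-distribˡ-boxSum n B z (F ∘ cons (suc k))))

boxSum-sumℕ : ∀ n B L (φ : ℕ → (Fin n → ℕ) → ℤ) →
              boxSum n B (λ k → sumℕ L (λ i → φ i k)) ≡ sumℕ L (λ i → boxSum n B (φ i))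
boxSum-sumℕ n B zero    φ = boxSum-zero n B
boxSum-sumℕ n B (suc L) φ = trans (boxSum-distrib-+ n B (λ k → sumℕ L (λ i → φ i k)) (φ L))
                                  (cong (ℤ._+ boxSum n B (φ L)) (boxSum-sumℕ n B L φ))

HasSum-cong : ∀ n {F F′ S S′} → (∀ k → F k ≈ₚ F′ k) → S ≈ₚ S′ → HasSum n F S → HasSum n F′ S′
HasSum-cong n F≈F′ S≈S′ hasSum N =
  eventually-map (λ {B} sum≡S → trans (boxSum-cong n B (λ k → sym (F≈F′ k N))) (trans sum≡S (S≈S′ N))) (hasSum N)

HasSum-*ˡ : ∀ n t {F S} → HasSum n F S → HasSum n (λ k → t *ₚ F k) (t *ₚ S)
HasSum-*ˡ n t {F} {S} hasSum N = eventually-map termwise (eventually-∀< (suc N) (λ i _ → hasSum (N ∸ i)))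
  where
  termwise : ∀ {B} → (∀ i → i < suc N → boxSum n B (λ k → F k (N ∸ i)) ≡ S (N ∸ i)) →
             boxSum n B (λ k → (t *ₚ F k) N) ≡ (t *ₚ S) N
  termwise {B} sums = trans (boxSum-sumℕ n B (suc N) (λ i k → t i ℤ.* F k (N ∸ i)))
    (sumℕ-cong-< (suc N) (λ i i<1+N → trans (sym (*-distribˡ-boxSum n B (t i) (λ k → F k (N ∸ i))))
                                            (cong (t i ℤ.*_) (sums i i<1+N))))

HasSum-q^∣ : ∀ n {F S d} → HasSum n F S → (∀ k → q^ d ∣ F k) → q^ d ∣ S
HasSum-q^∣ n {F} hasSum d∣F i i<d with hasSum i
... | B , ev = trans (sym (ev B ℕP.≤-refl)) (trans (boxSum-cong n B (λ k → d∣F k i i<d)) (boxSum-zero n B))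

HasSum-suc : ∀ n {F : (Fin (suc n) → ℕ) → PS} {Sₖ : ℕ → PS} {S : PS} →
             (∀ k → HasSum n (F ∘ cons (suc k)) (Sₖ k)) →
             (∀ k ks → q^ suc k ∣ F (cons (suc k) ks)) →
             (∀ B → q^ B ∣ S -ₚ sumₚ B Sₖ) →
             HasSum (suc n) F S
HasSum-suc n {F} {Sₖ} {S} inner small converges N =
  eventually-map agree (eventually-× (eventually-∀< N (λ k _ → inner k N)) (eventually-≥ (suc N)))
  where
  agree : ∀ {B} → (∀ k → k < N → boxSum n B (λ ks → F (cons (suc k) ks) N) ≡ Sₖ k N) × N < B →
          boxSum (suc n) B (λ k → F k N) ≡ S N
  agree {B} (early , N<B) =
    trans (sumℕ-cong B termwise) (sym (ℤP.i-j≡0⇒i≡j (S N) (sumₚ B Sₖ N) (converges B N N<B)))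
    where
    termwise : ∀ k → boxSum n B (λ ks → F (cons (suc k) ks) N) ≡ Sₖ k N
    termwise k with k <? N
    ... | yes k<N = early k k<N
    ... | no  k≮N = trans (boxSum-cong n B (λ ks → small k ks N N<1+k))
                          (trans (boxSum-zero n B) (sym (HasSum-q^∣ n (inner k) (small k) N N<1+k)))
      where
      N<1+k = s≤s (ℕP.≮⇒≥ k≮N)

-- The main induction

-- LHSterm m is offsetTerm 0 m definitionally.
offsetTerm : ℕ → ∀ {n} → (Fin n → ℕ) → (Fin n → ℕ) → PS
offsetTerm c m k = prodFin (λ j → T (c + Kj k j + Mprev m j) (m j))

tailWeights : ∀ {n} → (Fin n → ℕ) → PS
tailWeights m = prodFin (λ j → W (tailSum m j))

offsetRHS : ℕ → ∀ {n} → (Fin n → ℕ) → PS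
offsetRHS c {n} m = (num c (psum m n) /ₚ den (c + 2) (psum m n)) *ₚ tailWeights m

psum-zero : ∀ {n} (f : Fin n → ℕ) → psum f 0 ≡ 0
psum-zero {zero}  f = refl
psum-zero {suc n} f = refl

offsetTerm-cons : ∀ c {n} (m : Fin (suc n) → ℕ) k ks →
  offsetTerm c m (cons (suc k) ks) ≈ₚ (T (c + 2 * suc k) (m zero) *ₚ offsetTerm (c + 2 * suc k + 2 * m zero) (m ∘ suc) ks)
offsetTerm-cons c m k ks =
  *-cong (cong-app (cong (λ a → T a (m zero)) first))
         (prodFin-cong (λ j → cong-app (cong (λ a → T a (m (suc j))) (later (psum ks (suc (toℕ j))) (psum (m ∘ suc) (toℕ j))))))
  where
  drop-zeros : ∀ c k → c + 2 * (suc k + 0) + 2 * 0 ≡ c + 2 * suc k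
  drop-zeros = ℕ-Solver.solve-∀
  first : c + 2 * (suc k + psum ks 0) + 2 * 0 ≡ c + 2 * suc k
  first rewrite psum-zero ks = drop-zeros c k
  regroup : ∀ c k m₀ x y → c + 2 * (suc k + x) + 2 * (m₀ + y) ≡ c + 2 * suc k + 2 * m₀ + 2 * x + 2 * y
  regroup = ℕ-Solver.solve-∀
  later : ∀ x y → c + 2 * (suc k + x) + 2 * (m zero + y) ≡ c + 2 * suc k + 2 * m zero + 2 * x + 2 * y
  later = regroup c k (m zero)

tailWeights-cons : ∀ {n} (m : Fin (suc n) → ℕ) → tailWeights m ≈ₚ (W (psum m (suc n)) *ₚ tailWeights (m ∘ suc))
tailWeights-cons {n} m = *-congˡ {W (psum m (suc n))} (prodFin-cong {f = λ j → W (tailSum m (suc j))} (λ j → cong-app (cong W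
  (ℕP.[m+n]∸[m+o]≡n∸o (m zero) (psum (m ∘ suc) n) (psum (m ∘ suc) (toℕ j))))))

offsetRHS-empty : ∀ c (m : Fin 0 → ℕ) → offsetRHS c m ≈ₚ 1ₚ
offsetRHS-empty c m = ≈ₚ-trans (*-identityʳ (1ₚ /ₚ 1ₚ)) (≈ₚ-trans (*-identityˡ (inv 1ₚ)) inv-1ₚ)

offsetTerm-hasSum : ∀ n c (m : Fin n → ℕ) → (∀ j → 1 ≤ m j) → HasSum n (offsetTerm c m) (offsetRHS c m)
offsetTerm-hasSum zero    c m _   N = 0 , λ _ _ → sym (offsetRHS-empty c m N)
offsetTerm-hasSum (suc n) c m m≥1 = HasSum-suc n {offsetTerm c m} {λ k → T (a k) M *ₚ tailWeights m′} {offsetRHS c m} inner small converges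
  where
  m′ = m ∘ suc
  M′ = psum m′ n
  M  = psum m (suc n)
  a : ℕ → ℕ
  a k = c + 2 * suc k
  k<a : ∀ k → suc k ≤ a k
  k<a k = ℕP.≤-trans (ℕP.m≤n*m (suc k) 2) (ℕP.m≤n+m (2 * suc k) c)
  1≤M : 1 ≤ M
  1≤M = ℕP.≤-trans (m≥1 zero) (ℕP.m≤m+n (m zero) M′)
  inner : ∀ k → HasSum n (offsetTerm c m ∘ cons (suc k)) (T (a k) M *ₚ tailWeights m′)
  inner k = HasSum-cong n (λ ks → ≈ₚ-sym (offsetTerm-cons c m k ks)) merged
              (HasSum-*ˡ n (T (a k) (m zero)) (offsetTerm-hasSum n (a k + 2 * m zero) m′ (m≥1 ∘ suc)))
    where
    merged : (T (a k) (m zero) *ₚ offsetRHS (a k + 2 * m zero) m′) ≈ₚ (T (a k) M *ₚ tailWeights m′)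
    merged = ≈ₚ-trans (≈ₚ-sym (*-assoc (T (a k) (m zero)) (num (a k + 2 * m zero) M′ /ₚ den (a k + 2 * m zero + 2) M′) (tailWeights m′)))
                      (*-congʳ {tailWeights m′} (T-merge (a k) (m zero) M′ (ℕP.≤-trans (s≤s z≤n) (k<a k))))
  small : ∀ k ks → q^ suc k ∣ offsetTerm c m (cons (suc k) ks)
  small k ks = q^∣-resp-≈ (≈ₚ-sym (offsetTerm-cons c m k ks))
                          (∣f⇒∣f*g (offsetTerm (a k + 2 * m zero) m′ ks) (q^∣-≤ (k<a k) (q^a∣T (a k) (m zero) (m≥1 zero))))
  converges : ∀ B → q^ B ∣ offsetRHS c m -ₚ sumₚ B (λ k → T (a k) M *ₚ tailWeights m′)
  converges B = q^∣-resp-≈ (≈ₚ-sym remainder)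
                           (∣f⇒∣f*g (tailWeights m′) (∣f⇒∣f*g (inv (1ₚ -ₚ qpow (2 * M))) (q^∣-≤ (ℕP.<⇒≤ (k<a B)) (q^a∣G (a B) M 1≤M))))
    where
    remainder = ≈ₚ-trans (-ₚ-cong (*-congˡ {num c M /ₚ den (c + 2) M} (tailWeights-cons m)) ≈ₚ-refl)
                         (T-sum-remainder c M (tailWeights m′) B 1≤M)

offsetRHS-0 : ∀ {n} (m : Fin n → ℕ) → offsetRHS 0 m ≈ₚ RHS m
offsetRHS-0 {n} m = *-congʳ {tailWeights m} (*-congˡ {num 0 M}
  (inv-cong (den-+2-const-1 0 M) (prodUpTo-cong M (λ i → +-cong {1ₚ} ≈ₚ-refl (cong-app (cong qpow (double-suc i)))))))
  where
  M = psum m n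
  double-suc : ∀ i → 2 + 2 * i ≡ 2 * (i + 1)
  double-suc = ℕ-Solver.solve-∀

lemma4p4 : (n : ℕ) → 1 ≤ n → (m : Fin n → ℕ) → (∀ j → 1 ≤ m j) →
           HasSum n (LHSterm m) (RHS m)
lemma4p4 n _ m m≥1 = HasSum-cong n (λ _ → ≈ₚ-refl) (offsetRHS-0 m) (offsetTerm-hasSum n 0 m m≥1)
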